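{- Let Agents $=\{A\}$ be a singleton (subscripts omitted). The sentence $[\mathrm{Pub}\ \Diamond\mathsf{true}]^*\Diamond\Box\mathsf{false}$ of $\mathcal L(\Sigma_{\mathrm{Pub}})$ is satisfiable (there is a state model $\mathbf S$ and $s\in S$ with $s\in[\![\cdot]\!]_{\mathbf S}$), but it is not satisfiable in any finite state model.
   Context: A state model is $\mathbf S=(S,\to,\|\cdot\|)$: a set, a binary relation and a valuation of atomic sentences. $\Sigma_{\mathrm{Pub}}$ is the action signature with one action type Pub and $\mathrm{Pub}\to\mathrm{Pub}$. In $\mathcal L(\Sigma_{\mathrm{Pub}})$, the program $\mathrm{Pub}\ \psi$ acts on $\mathbf S$ by producing the model $\mathbf S(\mathrm{Pub}\ \psi)$ whose states are $(s,\mathrm{Pub})$ for $s\in[\![\psi]\!]_{\mathbf S}$, with $(s,\mathrm{Pub})\to(t,\mathrm{Pub})$ iff $s\to t$ and valuation inherited from $s$ (an isomorphic copy of the submodel on $[\![\psi]\!]_{\mathbf S}$), related to $\mathbf S$ by $s\mapsto(s,\mathrm{Pub})$. For a program $\pi$, $\pi^*$ is the disjoint union of the iterates $\pi^0=\mathsf{skip}$ (identity), $\pi^{m+1}=\pi^m;\pi$ (sequential composition of model transformations and their relations), and $s\in[\![[\pi^*]\varphi]\!]_{\mathbf S}$ iff for every $m\ge0$ and every $t$ related to $s$ by the $m$-fold iterate, $t$ satisfies $\varphi$ in the $m$-fold updated model. $\Diamond\mathsf{true}$ holds at states with a successor; $\Diamond\Box\mathsf{false}$ holds at states having a successor with no successors.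 -}

module Defs where

open import Data.Nat using (ℕ; zero; suc)
open import Data.Fin using (Fin)
open import Data.Product using (Σ; _×_; _,_; ∃)
open import Data.Unit using (⊤)
open import Data.Empty using (⊥)
open import Relation.Binary.PropositionalEquality using (_≡_; subst)
open import Function.Bundles using (_↔_)

Atom : Set
Atom = ℕ

record StateModel : Set₁ where
  field
    St  : Set
    _⟶_ : St → St → Set
    val : Atom → St → Set
open StateModel public

mutual
  data Form : Set where
    true false : Form
    atom       : Atom → Form
    ~_         : Form → Form
    _∧_        : Form → Form → Form
    ◇_ □_      : Form → Form
    [_]_       : Prog → Form → Form

  data Prog : Set where
    Pub_  : Form → Prog
    skip  : Prog
    _⨾_   : Prog → Prog → Prog
    _*    : Prog → Prog

infixr 6 ~_ ◇_ □_ [_]_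
infixr 5 _∧_
infix  7 Pub_
infixl 8 _*

⨄ : (ℕ → StateModel) → StateModel
⨄ F = record
  { St  = Σ ℕ (λ m → St (F m))
  ; _⟶_ = λ { (m , x) (m' , y) → Σ (m ≡ m') (λ e → _⟶_ (F m') (subst (λ k → St (F k)) e x) y) }
  ; val = λ { p (m , x) → val (F m) p x }
  }

mutual
  ⟦_⟧ : Form → (S : StateModel) → St S → Set
  ⟦ true ⟧    S s = ⊤
  ⟦ false ⟧   S s = ⊥
  ⟦ atom p ⟧  S s = val S p s
  ⟦ ~ φ ⟧     S s = ⟦ φ ⟧ S s → ⊥
  ⟦ φ ∧ ψ ⟧   S s = ⟦ φ ⟧ S s × ⟦ ψ ⟧ S s
  ⟦ ◇ φ ⟧     S s = Σ (St S) (λ t → _⟶_ S s t × ⟦ φ ⟧ S t)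
  ⟦ □ φ ⟧     S s = (t : St S) → _⟶_ S s t → ⟦ φ ⟧ S t
  ⟦ [ π ] φ ⟧ S s = (t : St (upd π S)) → rel π S s t → ⟦ φ ⟧ (upd π S) t

  upd : Prog → StateModel → StateModel
  upd (Pub ψ) S = record
    { St  = Σ (St S) (⟦ ψ ⟧ S)
    ; _⟶_ = λ { (s , _) (t , _) → _⟶_ S s t }
    ; val = λ { p (s , _) → val S p s }
    }
  upd skip    S = S
  upd (π ⨾ σ) S = upd σ (upd π S)
  upd (π *)   S = ⨄ (λ m → iter π m S)

  rel : (π : Prog) (S : StateModel) → St S → St (upd π S) → Set
  rel (Pub ψ) S s (t , _) = s ≡ t
  rel skip    S s t       = s ≡ t
  rel (π ⨾ σ) S s t       = Σ (St (upd π S)) (λ u → rel π S s u × rel σ (upd π S) u t)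
  rel (π *)   S s (m , t) = relIter π m S s t

  -- m-fold iterate π^m  (π^0 = skip, π^(m+1) = π^m ; π)
  iter : Prog → ℕ → StateModel → StateModel
  iter π zero    S = S
  iter π (suc m) S = upd π (iter π m S)

  relIter : (π : Prog) (m : ℕ) (S : StateModel) → St S → St (iter π m S) → Set
  relIter π zero    S s t = s ≡ t
  relIter π (suc m) S s t =
    Σ (St (iter π m S)) (λ u → relIter π m S s u × rel π (iter π m S) u t)

Satisfiable : Form → Set₁
Satisfiable φ = Σ StateModel (λ S → Σ (St S) (λ s → ⟦ φ ⟧ S s))

Finite : StateModel → Set
Finite S = Σ ℕ (λ n → St S ↔ Fin n)

FinitelySatisfiable : Form → Set₁
FinitelySatisfiable φ = Σ StateModel (λ S → Finite S × Σ (St S) (λ s → ⟦ φ ⟧ S s))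

theSentence : Form
theSentence = [ (Pub (◇ true)) * ] (◇ (□ false))

module Submission where

open import Defs
open import Data.Product using (_×_)
open import Relation.Nullary using (¬_)
open import Data.Nat using (ℕ; zero; suc; _≤_; _<_; _≤′_; ≤′-refl; ≤′-step; z≤n; s≤s)
open import Data.Nat.Properties using (≤-refl; m≤n⇒m≤1+n; 1+n≰n; <-cmp; ≤⇒≤′)
open import Data.Product using (Σ; ∃; _,_; proj₁)
open import Data.Unit using (⊤; tt)
open import Data.Empty using (⊥-elim)
open import Data.Fin using (Fin; toℕ)
open import Data.Fin.Properties using (injective⇒≤; toℕ-injective)
open import Function using (_∘_)
open import Function.Bundles using (_↔_; Injection)
open import Function.Definitions using (Injective)
open import Function.Properties.Inverse using (↔⇒↣)
open import Relation.Binary.Definitions using (tri<; tri≈; tri>)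
open import Relation.Binary.PropositionalEquality using (_≡_; _≢_; refl; sym; subst; subst₂)

-- Iterating Pub ◇true deletes the dead ends again and again, so a state of S survives m rounds iff
-- it starts a path of length m.  The fan (a root seeing paths of every finite length) satisfies the
-- sentence at its root: after m rounds the path of length m has shrunk to a dead end.  Conversely
-- the sentence yields, for every m, a state surviving exactly m rounds; these are pairwise distinct,
-- which is impossible in a finite model.

module Iterates (ψ : Form) (S : StateModel) where

  Level : ℕ → StateModel
  Level m = iter (Pub ψ) m S

  origin : ∀ m → St (Level m) → St S
  origin zero    x       = x
  origin (suc m) (x , _) = origin m x

  origin-⟶ : ∀ m {x y} → _⟶_ (Level m) x y → _⟶_ S (origin m x) (origin m y)
  origin-⟶ zero    e = e
  origin-⟶ (suc m) e = origin-⟶ m e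

  ⟶-origin : ∀ m {x y} → _⟶_ S (origin m x) (origin m y) → _⟶_ (Level m) x y
  ⟶-origin zero    e = e
  ⟶-origin (suc m) e = ⟶-origin m e

  relIter⇒origin : ∀ m {s t} → relIter (Pub ψ) m S s t → origin m t ≡ s
  relIter⇒origin zero    r              = sym r
  relIter⇒origin (suc m) (_ , r , refl) = relIter⇒origin m r

  Survives : ℕ → St S → Set
  Survives m x = Σ (St (Level m)) λ w → origin m w ≡ x

  survives-anti : ∀ {m n x} → m ≤′ n → Survives n x → Survives m x
  survives-anti ≤′-refl         s             = s
  survives-anti (≤′-step m≤′n) ((w , _) , ew) = survives-anti m≤′n (w , ew)

module Iterates◇true (S : StateModel) where

  open Iterates (◇ true) S public

  survives-suc : ∀ m {x y} → Survives m x → Survives m y → _⟶_ S x y → Survives (suc m) x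
  survives-suc m (w , refl) (v , refl) e = (w , v , ⟶-origin m e , tt) , refl

  survives-suc⁻ : ∀ m {x} → Survives (suc m) x → ∃ λ y → _⟶_ S x y × Survives m y
  survives-suc⁻ m ((w , v , e , _) , refl) = origin m v , origin-⟶ m e , v , refl

  dead-end⇒¬survives-suc : ∀ m (d : St (Level m)) → (∀ z → ¬ _⟶_ (Level m) d z) →
                           ¬ Survives (suc m) (origin m d)
  dead-end⇒¬survives-suc m d dead s with survives-suc⁻ m s
  ... | _ , e , v , refl = dead v (⟶-origin m e)

⨄-◇□false⁺ : ∀ F {m t} → ⟦ ◇ □ false ⟧ (F m) t → ⟦ ◇ □ false ⟧ (⨄ F) (m , t)
⨄-◇□false⁺ F {m} (y , e , dead) = (m , y) , (refl , e) , λ { (_ , z) (refl , e′) → dead z e′ }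

⨄-◇□false⁻ : ∀ F {m t} → ⟦ ◇ □ false ⟧ (⨄ F) (m , t) → ⟦ ◇ □ false ⟧ (F m) t
⨄-◇□false⁻ F ((_ , y) , (refl , e) , dead) = y , e , λ z e′ → dead (_ , z) (refl , e′)

no-injection-ℕ→Finite : ∀ {A : Set} {n} → A ↔ Fin n → (f : ℕ → A) → ¬ Injective _≡_ _≡_ f
no-injection-ℕ→Finite A↔Fin f f-injective =
  1+n≰n (injective⇒≤ {f = Injection.to (↔⇒↣ A↔Fin) ∘ f ∘ toℕ}
           (toℕ-injective ∘ f-injective ∘ Injection.injective (↔⇒↣ A↔Fin)))

<-distinct⇒injective : ∀ {A : Set} (f : ℕ → A) → (∀ {i j} → i < j → f i ≢ f j) →
                        Injective _≡_ _≡_ f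
<-distinct⇒injective f distinct {i} {j} eq with <-cmp i j
... | tri< i<j _ _ = ⊥-elim (distinct i<j eq)
... | tri≈ _ i≡j _ = i≡j
... | tri> _ _ j<i = ⊥-elim (distinct j<i (sym eq))

module FanModel where

  data FanState : Set where
    root  : FanState
    chain : ℕ → FanState

  data _↝_ : FanState → FanState → Set where
    root↝  : ∀ d → root ↝ chain d
    chain↝ : ∀ d → chain (suc d) ↝ chain d

  Fan : StateModel
  Fan = record { St = FanState ; _⟶_ = _↝_ ; val = λ _ _ → ⊤ }

  _≤height_ : ℕ → FanState → Set
  m ≤height root    = ⊤
  m ≤height chain d = m ≤ d

  ≤height-step : ∀ {m x y} → x ↝ y → m ≤height y → suc m ≤height x
  ≤height-step (root↝ _)  _   = tt
  ≤height-step (chain↝ _) m≤d = s≤s m≤d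

  chain-edge-too-short : ∀ {m y} → chain m ↝ y → ¬ m ≤height y
  chain-edge-too-short (chain↝ _) = 1+n≰n

  open Iterates◇true Fan

  ≤height⇒survives : ∀ m x → m ≤height x → Survives m x
  ≤height⇒survives zero    x                _       = x , refl
  ≤height⇒survives (suc m) root             _       =
    survives-suc m (≤height⇒survives m root tt) (≤height⇒survives m (chain m) ≤-refl) (root↝ m)
  ≤height⇒survives (suc m) (chain (suc d)) (s≤s m≤d) =
    survives-suc m (≤height⇒survives m (chain (suc d)) (m≤n⇒m≤1+n m≤d))
                 (≤height⇒survives m (chain d) m≤d) (chain↝ d)

  survives⇒≤height : ∀ m x → Survives m x → m ≤height x
  survives⇒≤height zero    root      _ = tt
  survives⇒≤height zero    (chain _) _ = z≤n
  survives⇒≤height (suc m) x         s with survives-suc⁻ m s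
  ... | y , x↝y , sy = ≤height-step x↝y (survives⇒≤height m y sy)

  chain-dead-at-level : ∀ m (w : St (Level m)) → origin m w ≡ chain m → ∀ z → ¬ _⟶_ (Level m) w z
  chain-dead-at-level m w ow z e =
    chain-edge-too-short (subst (_↝ origin m z) ow (origin-⟶ m e)) (survives⇒≤height m (origin m z) (z , refl))

  origin≡root⇒◇□false : ∀ m t → origin m t ≡ root → ⟦ ◇ □ false ⟧ (Level m) t
  origin≡root⇒◇□false m t ot with ≤height⇒survives m (chain m) ≤-refl
  ... | w , ow = w , ⟶-origin m (subst₂ _↝_ (sym ot) (sym ow) (root↝ m)) , chain-dead-at-level m w ow

  theSentence-at-root : ⟦ theSentence ⟧ Fan root
  theSentence-at-root (m , t) r = ⨄-◇□false⁺ Level (origin≡root⇒◇□false m t (relIter⇒origin m r))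

module FiniteModels (S : StateModel) (s : St S) (sentence : ⟦ theSentence ⟧ S s) where

  open Iterates◇true S

  ◇□false-at : ∀ m t → relIter (Pub (◇ true)) m S s t → ⟦ ◇ □ false ⟧ (Level m) t
  ◇□false-at m t r = ⨄-◇□false⁻ Level (sentence (m , t) r)

  related : ∀ m → Σ (St (Level m)) (relIter (Pub (◇ true)) m S s)
  related zero = s , refl
  related (suc m) with related m
  ... | t , r with ◇□false-at m t r
  ... | y , e , _ = (t , y , e , tt) , t , r , refl

  deadEnd : ℕ → St S
  deadEnd m with related m
  ... | t , r = origin m (proj₁ (◇□false-at m t r))

  deadEnd-survives : ∀ m → Survives m (deadEnd m)
  deadEnd-survives m with related m
  ... | t , r = proj₁ (◇□false-at m t r) , refl

  deadEnd-¬survives-suc : ∀ m → ¬ Survives (suc m) (deadEnd m)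
  deadEnd-¬survives-suc m with related m
  ... | t , r with ◇□false-at m t r
  ... | d , _ , dead = dead-end⇒¬survives-suc m d dead

  deadEnd-injective : Injective _≡_ _≡_ deadEnd
  deadEnd-injective = <-distinct⇒injective deadEnd λ {i} {j} i<j eq →
    deadEnd-¬survives-suc i (subst (Survives (suc i)) (sym eq) (survives-anti (≤⇒≤′ i<j) (deadEnd-survives j)))

mainTheorem7 : Satisfiable theSentence × ¬ FinitelySatisfiable theSentence
mainTheorem7 = (Fan , root , theSentence-at-root)
             , λ { (S , (_ , S↔Fin) , s , sentence) →
                     no-injection-ℕ→Finite S↔Fin (FiniteModels.deadEnd S s sentence)
                                                 (FiniteModels.deadEnd-injective S s sentence) }
  where open FanModel
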